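{- Let $f:B^3\to B$, let $\mathbf{x}$ be a minimal transient vector with $3$ components, let $U=v_0v_1v_2v_3$ be a walk in $C_f$ with $v_0=\alpha(\mathbf{x})$, and let $W=Uv_4v_5$ be a walk in $C_f$ extending $U$. If $W$ is alternating, $c_U=0$, and $c_W\le1$, then there exists a complete optimal walk for $\mathbf{x}$.
   Context: $B=\{0,1\}$. A transient is a nonempty word over $B$ with consecutive letters different; the contraction of a nonempty binary word deletes every letter equal to its predecessor; $\mathbf{s}\circ\mathbf{t}$ is the contraction of $\mathbf{s}\mathbf{t}$. A transient vector is a tuple of transients, with $\circ$ componentwise and $\alpha(\mathbf{x})$ the binary vector of first letters; a binary vector is regarded as a transient vector with length-1 components. A vector is minimal if each component has length $2$ or $3$. $C_f$ is the $3$-cube on $B^3$ (vertices adjacent iff differing in exactly one coordinate), vertex $v$ labelled $f(v)$; an edge is in coordinate $i$ if its endpoints differ in coordinate $i$, and is live if $f$ differs at its endpoints. A walk $W=w^1,\ldots,w^r$ (consecutive vertices adjacent) has cost $c_W=|\{j<r: f(w^j)=f(w^{j+1})\}|$; it is a walk for $\mathbf{x}$ if $\mathbf{x}=w^1\circ\cdots\circ w^r$; it is optimal for $\mathbf{x}$ if the contraction of $f(w^1)\cdots f(w^r)$ has maximal length among walks for $\mathbf{x}$ (equivalently, $c_W$ minimal among walks for $\mathbf{x}$). A walk is complete if for every coordinate $i$ there is a live edge in coordinate $i$ sharing at least one vertex with the walk. A walk $v_0v_1v_2v_3v_4v_5$ in $C_f$ is alternating if for each $i\in\{0,1,2\}$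 the subwalk $v_iv_{i+1}v_{i+2}v_{i+3}$ contains a step changing each of the three coordinates. -}

module Defs where

open import Data.Bool using (Bool; true; false; _∧_; if_then_else_; not; _xor_)

_≡ᵇ_ : Bool → Bool → Bool
a ≡ᵇ b = not (a xor b)
open import Data.Bool.Properties using () renaming (_≟_ to _≟B_)
open import Data.Nat using (ℕ; zero; suc; _+_; _≤_)
open import Data.Fin using (Fin)
open import Data.List using (List; []; _∷_; _++_; [_]; length; foldl)
open import Data.Vec using (Vec; lookup; map)
open import Data.Product using (Σ; _×_; _,_; ∃)
open import Data.Sum using (_⊎_)
open import Relation.Nullary using (¬_; Dec; yes; no)
open import Relation.Binary.PropositionalEquality using (_≡_; _≢_)
open import Data.List.Membership.Propositional using (_∈_)

-- B = Bool.  A binary word is a List Bool.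

data Alternates : List Bool → Set where
  alt-[]  : Alternates []
  alt-[x] : ∀ {x} → Alternates (x ∷ [])
  alt-∷   : ∀ {x y w} → x ≢ y → Alternates (y ∷ w) → Alternates (x ∷ y ∷ w)

Transient : List Bool → Set
Transient w = (w ≢ []) × Alternates w

contractFrom : Bool → List Bool → List Bool
contractFrom a [] = []
contractFrom a (b ∷ w) with a ≟B b
... | yes _ = contractFrom a w
... | no  _ = b ∷ contractFrom b w

contract : List Bool → List Bool
contract []      = []
contract (x ∷ w) = x ∷ contractFrom x w

_∘ᵗ_ : List Bool → List Bool → List Bool
s ∘ᵗ t = contract (s ++ t)

TVec : Set
TVec = Vec (List Bool) 3

IsTransientVector : TVec → Set
IsTransientVector x = ∀ (i : Fin 3) → Transient (lookup x i)

Minimal : TVec → Set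
Minimal x = ∀ (i : Fin 3) → (length (lookup x i) ≡ 2) ⊎ (length (lookup x i) ≡ 3)

-- vector of first letters (default false for the empty word, never used
-- for transient vectors, whose components are nonempty)
head₀ : List Bool → Bool
head₀ []      = false
head₀ (b ∷ _) = b

α : TVec → Vec Bool 3
α x = map head₀ x

Vertex : Set
Vertex = Vec Bool 3

DiffersAt : Vertex → Vertex → Fin 3 → Set
DiffersAt u v i = lookup u i ≢ lookup v i

Adjacent : Vertex → Vertex → Set
Adjacent u v = Σ (Fin 3) λ i → DiffersAt u v i × (∀ (j : Fin 3) → DiffersAt u v j → j ≡ i)

data Chain : List Vertex → Set where
  ch-[x] : ∀ {v} → Chain (v ∷ [])
  ch-∷   : ∀ {u v W} → Adjacent u v → Chain (v ∷ W) → Chain (u ∷ v ∷ W)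

IsWalk : List Vertex → Set
IsWalk W = Chain W

costFrom : (Vertex → Bool) → Vertex → List Vertex → ℕ
costFrom f u []      = 0
costFrom f u (v ∷ W) = (if (f u ≡ᵇ f v) then 1 else 0) + costFrom f v W

cost : (Vertex → Bool) → List Vertex → ℕ
cost f []      = 0
cost f (u ∷ W) = costFrom f u W

-- w^1 ∘ ... ∘ w^r in component i (binary vectors as length-1 words),
-- bracketed from the left (∘ is associative)
walkProduct : Fin 3 → List Vertex → List Bool
walkProduct i []      = []
walkProduct i (w ∷ W) = foldl (λ acc v → acc ∘ᵗ [ lookup v i ]) [ lookup w i ] W

WalkFor : TVec → List Vertex → Set
WalkFor x W = IsWalk W × (∀ (i : Fin 3) → lookup x i ≡ walkProduct i W)

Optimal : (Vertex → Bool) → TVec → List Vertex → Set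
Optimal f x W = WalkFor x W × (∀ W′ → WalkFor x W′ → cost f W ≤ cost f W′)

Live : (Vertex → Bool) → Vertex → Vertex → Set
Live f u v = f u ≢ f v

Complete : (Vertex → Bool) → List Vertex → Set
Complete f W = ∀ (i : Fin 3) → Σ Vertex λ u → Σ Vertex λ v →
  Adjacent u v × DiffersAt u v i × Live f u v × ((u ∈ W) ⊎ (v ∈ W))

Changes : Vertex → Vertex → Fin 3 → Set
Changes a b k = DiffersAt a b k

AllCoordsChanged : Vertex → Vertex → Vertex → Vertex → Set
AllCoordsChanged a b c d = ∀ (k : Fin 3) → Changes a b k ⊎ (Changes b c k ⊎ Changes c d k)

Alternating : Vertex → Vertex → Vertex → Vertex → Vertex → Vertex → Set
Alternating v0 v1 v2 v3 v4 v5 =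
  AllCoordsChanged v0 v1 v2 v3 × AllCoordsChanged v1 v2 v3 v4 × AllCoordsChanged v2 v3 v4 v5

-- A walk from v that toggles coordinate i exactly k i times multiplies out, in
-- component i, to the alternating word of length k i + 1 starting with v i; so the
-- walks for a transient vector x are the walks from α x with k i = |x i| - 1.
-- If one of them has cost 0 it is complete, since each coordinate is toggled (x is
-- minimal) along a live edge. Otherwise every walk for x costs at least 1, and any
-- complete walk for x of cost at most 1 is optimal. Alternation forces W to toggle
-- coordinates a, b, c, a, b with {a, b, c} = {0, 1, 2}, and U has three live edges,
-- one per coordinate, so every walk starting with U is complete. The required
-- extra toggles are appended to U by following W, by retracing U (free, as its
-- edges are live), and by at most one further step, which costs at most 1.

module Submission where

open import Defs
open import Data.Bool using (Bool; true; false; not; if_then_else_)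
open import Data.Bool.Properties using (not-involutive; not-¬; ¬-not; xor-comm) renaming (_≟_ to _≟B_)
open import Data.Nat using (ℕ; zero; suc; _+_; _∸_; _≤_; z≤n; s≤s; _≟_)
open import Data.Nat.Properties
  using (+-identityʳ; +-suc; suc-injective; m+n≡0⇒m≡0; m+n≡0⇒n≡0; n≢0⇒n>0; n≤0⇒n≡0;
         +-monoʳ-≤; ≤-trans; ≤-reflexive; module ≤-Reasoning)
open import Data.Fin using (Fin)
open import Data.Fin.Patterns using (0F; 1F; 2F)
open import Data.Fin.Properties using (all?) renaming (_≟_ to _≟F_)
import Data.List as List
open import Data.List using (List; []; _∷_; _++_; [_]; length; foldl; cartesianProductWith; allFin)
open import Data.List.Membership.Propositional using (_∈_; lose)
open import Data.List.Membership.Propositional.Properties using (∈-cartesianProductWith⁺; ∈-allFin)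
open import Data.List.Relation.Unary.Any using (here; there; any?; satisfied)
open import Data.Vec using (Vec; lookup; updateAt)
open import Data.Vec.Properties
  using (lookup∘updateAt; lookup∘updateAt′; updateAt-updateAt; updateAt-cong; updateAt-id; lookup-map)
open import Data.Vec.Relation.Binary.Pointwise.Extensional using (ext; Pointwise-≡⇒≡)
open import Data.Product using (Σ; ∃; ∃-syntax; _×_; _,_; proj₁; proj₂)
open import Data.Sum as Sum using (_⊎_; inj₁; inj₂)
open import Data.Empty using (⊥-elim)
open import Function using (_∘_; case_of_)
open import Function.Definitions using (Injective)
open import Relation.Nullary using (¬?; yes; no; Dec; _×-dec_; _⊎-dec_; _→-dec_)
open import Relation.Nullary.Decidable using (toWitness)
open import Relation.Unary using (Decidable)
open import Relation.Binary.PropositionalEquality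
  using (_≡_; _≢_; refl; sym; trans; cong; cong₂; subst; module ≡-Reasoning)

-- Alternating words

alternation : Bool → ℕ → List Bool
alternation a zero    = [ a ]
alternation a (suc n) = a ∷ alternation (not a) n

lastLetter : Bool → ℕ → Bool
lastLetter a zero    = a
lastLetter a (suc n) = lastLetter (not a) n

lastLetter-suc : ∀ a n → lastLetter a (suc n) ≡ not (lastLetter a n)
lastLetter-suc a zero    = refl
lastLetter-suc a (suc n) = lastLetter-suc (not a) n

contract-repeat : ∀ a w → contract (a ∷ a ∷ w) ≡ contract (a ∷ w)
contract-repeat a w with a ≟B a
... | yes _  = refl
... | no a≢a = ⊥-elim (a≢a refl)

contract-switch : ∀ a w → contract (a ∷ not a ∷ w) ≡ a ∷ contract (not a ∷ w)
contract-switch a w with a ≟B not a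
... | yes a≡¬a = ⊥-elim (not-¬ refl a≡¬a)
... | no _     = refl

contract-switch-alternation : ∀ a n w →
  contract (a ∷ alternation (not a) n ++ w) ≡ a ∷ contract (alternation (not a) n ++ w)
contract-switch-alternation a zero    w = contract-switch a w
contract-switch-alternation a (suc n) w = contract-switch a _

alternation-∘ᵗ-lastLetter : ∀ a n → alternation a n ∘ᵗ [ lastLetter a n ] ≡ alternation a n
alternation-∘ᵗ-lastLetter a zero    = contract-repeat a []
alternation-∘ᵗ-lastLetter a (suc n) =
  trans (contract-switch-alternation a n _) (cong (a ∷_) (alternation-∘ᵗ-lastLetter (not a) n))

alternation-∘ᵗ-not-lastLetter : ∀ a n → alternation a n ∘ᵗ [ not (lastLetter a n) ] ≡ alternation a (suc n)
alternation-∘ᵗ-not-lastLetter a zero    = contract-switch a []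
alternation-∘ᵗ-not-lastLetter a (suc n) =
  trans (contract-switch-alternation a n _) (cong (a ∷_) (alternation-∘ᵗ-not-lastLetter (not a) n))

alternates⇒alternation : ∀ {a w} → Alternates (a ∷ w) → a ∷ w ≡ alternation a (length w)
alternates⇒alternation alt-[x] = refl
alternates⇒alternation {a} (alt-∷ a≢b alt) with refl ← ¬-not (a≢b ∘ sym) =
  cong (a ∷_) (alternates⇒alternation alt)

length-alternation : ∀ a n → length (alternation a n) ≡ suc n
length-alternation a zero    = refl
length-alternation a (suc n) = cong suc (length-alternation (not a) n)

head-alternation : ∀ a n → head₀ (alternation a n) ≡ a
head-alternation a zero    = refl
head-alternation a (suc n) = refl

alternation-injective : ∀ {a b m n} → alternation a m ≡ alternation b n → a ≡ b × m ≡ n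
alternation-injective {a} {b} {m} {n} eq =
  trans (sym (head-alternation a m)) (trans (cong head₀ eq) (head-alternation b n)) ,
  suc-injective (trans (sym (length-alternation a m)) (trans (cong length eq) (length-alternation b n)))

transient⇒alternation : ∀ {w} → Transient w → w ≡ alternation (head₀ w) (length w ∸ 1)
transient⇒alternation {[]}    (w≢[] , _) = ⊥-elim (w≢[] refl)
transient⇒alternation {_ ∷ _} (_ , alt)  = alternates⇒alternation alt

-- The cube

toggle : ∀ {n} → Fin n → Vec Bool n → Vec Bool n
toggle i v = updateAt v i not

lookup-toggle : ∀ {n} (i : Fin n) v → lookup (toggle i v) i ≡ not (lookup v i)
lookup-toggle i v = lookup∘updateAt i v

lookup-toggle-≢ : ∀ {n} {i j : Fin n} v → j ≢ i → lookup (toggle i v) j ≡ lookup v j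
lookup-toggle-≢ {i = i} {j} v j≢i = lookup∘updateAt′ j i j≢i v

toggle-involutive : ∀ {n} (i : Fin n) v → toggle i (toggle i v) ≡ v
toggle-involutive i v = begin
  updateAt (updateAt v i not) i not ≡⟨ updateAt-updateAt i v ⟩
  updateAt v i (not ∘ not)          ≡⟨ updateAt-cong i not-involutive v ⟩
  updateAt v i (λ b → b)            ≡⟨ updateAt-id i v ⟩
  v                                 ∎
  where open ≡-Reasoning

toggle-differs : ∀ {n} (i : Fin n) v → lookup v i ≢ lookup (toggle i v) i
toggle-differs i v eq = not-¬ refl (trans eq (lookup-toggle i v))

toggle-differsAt : ∀ {i k} v → DiffersAt v (toggle i v) k → k ≡ i
toggle-differsAt {i} {k} v d with k ≟F i
... | yes k≡i = k≡i
... | no k≢i  = ⊥-elim (d (sym (lookup-toggle-≢ v k≢i)))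

adjacent-toggle : ∀ i v → Adjacent v (toggle i v)
adjacent-toggle i v = i , toggle-differs i v , λ k → toggle-differsAt v

adjacent⇒toggle : ∀ {u v} → Adjacent u v → ∃ λ i → v ≡ toggle i u
adjacent⇒toggle {u} {v} (i , uᵢ≢vᵢ , only-i) = i , Pointwise-≡⇒≡ (ext agree)
  where
  unchanged : ∀ {k} → k ≢ i → lookup u k ≡ lookup v k
  unchanged {k} k≢i with lookup u k ≟B lookup v k
  ... | yes eq = eq
  ... | no neq = ⊥-elim (k≢i (only-i k neq))

  agree : ∀ k → lookup v k ≡ lookup (toggle i u) k
  agree k with k ≟F i
  ... | yes refl = trans (¬-not (uᵢ≢vᵢ ∘ sym)) (sym (lookup-toggle i u))
  ... | no k≢i   = trans (sym (unchanged k≢i)) (sym (lookup-toggle-≢ u k≢i))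

-- Walks as toggle sequences

count : ∀ {n} → Fin n → List (Fin n) → ℕ
count i []       = 0
count i (j ∷ js) with i ≟F j
... | yes _ = suc (count i js)
... | no _  = count i js

path : ∀ {n} → Vec Bool n → List (Fin n) → List (Vec Bool n)
path v []       = []
path v (j ∷ js) = toggle j v ∷ path (toggle j v) js

trace : ∀ {n} → Vec Bool n → List (Fin n) → List (Vec Bool n)
trace v js = v ∷ path v js

trace-isWalk : ∀ v js → IsWalk (trace v js)
trace-isWalk v []       = ch-[x]
trace-isWalk v (j ∷ js) = ch-∷ (adjacent-toggle j v) (trace-isWalk (toggle j v) js)

isWalk⇒trace : ∀ {v W} → IsWalk (v ∷ W) → ∃ λ js → W ≡ path v js
isWalk⇒trace ch-[x] = [] , refl
isWalk⇒trace {v} (ch-∷ {v = w} adj walk) with adjacent⇒toggle {v} {w} adj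
... | j , refl with isWalk⇒trace walk
...   | js , refl = j ∷ js , refl

foldl-∘ᵗ-path : ∀ (i : Fin 3) a m (v : Vertex) js → lastLetter a m ≡ lookup v i →
  foldl (λ acc w → acc ∘ᵗ [ lookup w i ]) (alternation a m) (path v js) ≡ alternation a (m + count i js)
foldl-∘ᵗ-path i a m v [] _ = cong (alternation a) (sym (+-identityʳ m))
foldl-∘ᵗ-path i a m v (j ∷ js) last≡ with i ≟F j
... | yes refl = begin
  foldl step (alternation a m ∘ᵗ [ lookup (toggle i v) i ]) (path (toggle i v) js)
    ≡⟨ cong (λ b → foldl step (alternation a m ∘ᵗ [ b ]) (path (toggle i v) js)) toggled ⟩
  foldl step (alternation a m ∘ᵗ [ not (lastLetter a m) ]) (path (toggle i v) js)
    ≡⟨ cong (λ w → foldl step w (path (toggle i v) js)) (alternation-∘ᵗ-not-lastLetter a m) ⟩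
  foldl step (alternation a (suc m)) (path (toggle i v) js)
    ≡⟨ foldl-∘ᵗ-path i a (suc m) (toggle i v) js (trans (lastLetter-suc a m) (sym toggled)) ⟩
  alternation a (suc m + count i js)
    ≡⟨ cong (alternation a) (sym (+-suc m (count i js))) ⟩
  alternation a (m + suc (count i js)) ∎
  where
  open ≡-Reasoning
  step = λ acc w → acc ∘ᵗ [ lookup w i ]
  toggled : lookup (toggle i v) i ≡ not (lastLetter a m)
  toggled = trans (lookup-toggle i v) (cong not (sym last≡))
... | no i≢j = begin
  foldl step (alternation a m ∘ᵗ [ lookup (toggle j v) i ]) (path (toggle j v) js)
    ≡⟨ cong (λ b → foldl step (alternation a m ∘ᵗ [ b ]) (path (toggle j v) js)) unmoved ⟩
  foldl step (alternation a m ∘ᵗ [ lastLetter a m ]) (path (toggle j v) js)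
    ≡⟨ cong (λ w → foldl step w (path (toggle j v) js)) (alternation-∘ᵗ-lastLetter a m) ⟩
  foldl step (alternation a m) (path (toggle j v) js)
    ≡⟨ foldl-∘ᵗ-path i a m (toggle j v) js (sym unmoved) ⟩
  alternation a (m + count i js) ∎
  where
  open ≡-Reasoning
  step = λ acc w → acc ∘ᵗ [ lookup w i ]
  unmoved : lookup (toggle j v) i ≡ lastLetter a m
  unmoved = trans (lookup-toggle-≢ v i≢j) (sym last≡)

walkProduct-trace : ∀ i (v : Vertex) js → walkProduct i (trace v js) ≡ alternation (lookup v i) (count i js)
walkProduct-trace i v js = foldl-∘ᵗ-path i (lookup v i) 0 v js refl

flips : TVec → Fin 3 → ℕ
flips x i = length (lookup x i) ∸ 1

Counts : List (Fin 3) → (Fin 3 → ℕ) → Set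
Counts js k = ∀ i → count i js ≡ k i

component-alternation : ∀ {x} → IsTransientVector x →
  ∀ i → lookup x i ≡ alternation (lookup (α x) i) (flips x i)
component-alternation {x} tx i =
  trans (transient⇒alternation (tx i)) (cong (λ a → alternation a (flips x i)) (sym (lookup-map i head₀ x)))

walkFor-trace : ∀ {x js} → IsTransientVector x → Counts js (flips x) → WalkFor x (trace (α x) js)
walkFor-trace {x} {js} tx counts = trace-isWalk (α x) js , λ i → begin
  lookup x i                                   ≡⟨ component-alternation {x} tx i ⟩
  alternation (lookup (α x) i) (flips x i)     ≡⟨ cong (alternation _) (sym (counts i)) ⟩
  alternation (lookup (α x) i) (count i js)    ≡⟨ walkProduct-trace i (α x) js ⟨
  walkProduct i (trace (α x) js)               ∎
  where open ≡-Reasoning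

trace-start-and-counts : ∀ {x w js} → IsTransientVector x →
  (∀ i → lookup x i ≡ walkProduct i (trace w js)) → w ≡ α x × Counts js (flips x)
trace-start-and-counts {x} {w} {js} tx product = Pointwise-≡⇒≡ (ext (proj₁ ∘ agrees)) , proj₂ ∘ agrees
  where
  agrees : ∀ i → lookup w i ≡ lookup (α x) i × count i js ≡ flips x i
  agrees i = alternation-injective
    (trans (sym (walkProduct-trace i w js)) (trans (sym (product i)) (component-alternation {x} tx i)))

walkFor⇒trace : ∀ {x W} → IsTransientVector x → WalkFor x W →
  ∃ λ js → W ≡ trace (α x) js × Counts js (flips x)
walkFor⇒trace {x} {[]}    tx (_ , product) = ⊥-elim (proj₁ (tx 0F) (product 0F))
walkFor⇒trace {x} {w ∷ _} tx (walk , product) with isWalk⇒trace walk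
... | js , refl with trace-start-and-counts {x} {w} {js} tx product
...   | refl , counts = js , refl , counts

-- Costs

stepCost : (Vertex → Bool) → Vertex → Vertex → ℕ
stepCost f u v = if f u ≡ᵇ f v then 1 else 0

free-step⇒live : ∀ f u v → stepCost f u v ≡ 0 → Live f u v
free-step⇒live f u v free with f u | f v
... | true  | false = λ ()
... | false | true  = λ ()

≡ᵇ-comm : ∀ a b → (a ≡ᵇ b) ≡ (b ≡ᵇ a)
≡ᵇ-comm a b = cong not (xor-comm a b)

retrace-free : ∀ f (u₀ u₁ u₂ u₃ : Vertex) → cost f (u₀ ∷ u₁ ∷ u₂ ∷ u₃ ∷ []) ≡ 0 →
  cost f (u₀ ∷ u₁ ∷ u₂ ∷ u₃ ∷ u₂ ∷ u₁ ∷ []) ≡ 0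
retrace-free f u₀ u₁ u₂ u₃ free rewrite ≡ᵇ-comm (f u₃) (f u₂) | ≡ᵇ-comm (f u₂) (f u₁) =
  retrace (stepCost f u₀ u₁) (stepCost f u₁ u₂) (stepCost f u₂ u₃) free
  where
  retrace : ∀ l m n → l + (m + (n + 0)) ≡ 0 → l + (m + (n + (n + (m + 0)))) ≡ 0
  retrace zero zero zero _ = refl

stepCost-≤1 : ∀ f u v → stepCost f u v ≤ 1
stepCost-≤1 f u v with f u ≡ᵇ f v
... | true  = s≤s z≤n
... | false = z≤n

cost-trace-prefix : ∀ f v js ks → cost f (trace v js) ≤ cost f (trace v (js ++ ks))
cost-trace-prefix f v []       ks = z≤n
cost-trace-prefix f v (j ∷ js) ks =
  +-monoʳ-≤ (stepCost f v (toggle j v)) (cost-trace-prefix f (toggle j v) js ks)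

cost-trace-snoc : ∀ f v js k → cost f (trace v (js ++ [ k ])) ≤ suc (cost f (trace v js))
cost-trace-snoc f v []       k = ≤-trans (≤-reflexive (+-identityʳ _)) (stepCost-≤1 f v (toggle k v))
cost-trace-snoc f v (j ∷ js) k = begin
  stepCost f v (toggle j v) + cost f (trace (toggle j v) (js ++ [ k ]))
    ≤⟨ +-monoʳ-≤ (stepCost f v (toggle j v)) (cost-trace-snoc f (toggle j v) js k) ⟩
  stepCost f v (toggle j v) + suc (cost f (trace (toggle j v) js))
    ≡⟨ +-suc _ _ ⟩
  suc (stepCost f v (toggle j v) + cost f (trace (toggle j v) js)) ∎
  where open ≤-Reasoning

-- Completeness

complete-from-live-toggles : ∀ f W → (∀ i → ∃ λ u → u ∈ W × Live f u (toggle i u)) → Complete f W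
complete-from-live-toggles f W live i with live i
... | u , u∈W , uLive = u , toggle i u , adjacent-toggle i u , toggle-differs i u , uLive , inj₁ u∈W

free-trace-live : ∀ f v js {i} → cost f (trace v js) ≡ 0 → i ∈ js →
  ∃ λ u → u ∈ trace v js × Live f u (toggle i u)
free-trace-live f v (j ∷ js) free (here refl) =
  v , here refl , free-step⇒live f v (toggle j v) (m+n≡0⇒m≡0 _ free)
free-trace-live f v (j ∷ js) free (there i∈js)
  with free-trace-live f (toggle j v) js (m+n≡0⇒n≡0 _ free) i∈js
... | u , u∈trace , uLive = u , there u∈trace , uLive

∈-trace-++ : ∀ {n u} (v : Vec Bool n) js ks → u ∈ trace v js → u ∈ trace v (js ++ ks)
∈-trace-++ v js       ks (here refl)  = here refl
∈-trace-++ v (j ∷ js) ks (there u∈js) = there (∈-trace-++ (toggle j v) js ks u∈js)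

free-trace-complete : ∀ f v js → cost f (trace v js) ≡ 0 → (∀ i → i ∈ js) → Complete f (trace v js)
free-trace-complete f v js free all∈ =
  complete-from-live-toggles f (trace v js) λ i → free-trace-live f v js free (all∈ i)

complete-trace-++ : ∀ f v js ks → Complete f (trace v js) → Complete f (trace v (js ++ ks))
complete-trace-++ f v js ks complete i with complete i
... | u , w , edge , differs , live , touches =
  u , w , edge , differs , live , Sum.map (∈-trace-++ v js ks) (∈-trace-++ v js ks) touches

-- Searching by letter counts

count≢0⇒∈ : ∀ {n} {i : Fin n} js → count i js ≢ 0 → i ∈ js
count≢0⇒∈         []       c≢0 = ⊥-elim (c≢0 refl)
count≢0⇒∈ {i = i} (j ∷ js) c≢0 with i ≟F j
... | yes refl = here refl
... | no _     = there (count≢0⇒∈ js c≢0)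

length≡sum-of-counts : ∀ (js : List (Fin 3)) → length js ≡ count 0F js + (count 1F js + count 2F js)
length≡sum-of-counts []        = refl
length≡sum-of-counts (0F ∷ js) = cong suc (length≡sum-of-counts js)
length≡sum-of-counts (1F ∷ js) = trans (cong suc (length≡sum-of-counts js)) (sym (+-suc (count 0F js) _))
length≡sum-of-counts (2F ∷ js) = trans (cong suc (length≡sum-of-counts js))
  (sym (trans (cong (count 0F js +_) (+-suc (count 1F js) _)) (+-suc (count 0F js) _)))

words : ∀ {A : Set} → List A → ℕ → List (List A)
words as zero    = [ [] ]
words as (suc n) = cartesianProductWith _∷_ as (words as n)

∈-words : ∀ {A : Set} {as : List A} → (∀ a → a ∈ as) → ∀ ws → ws ∈ words as (length ws)
∈-words all∈ []       = here refl
∈-words all∈ (w ∷ ws) = ∈-cartesianProductWith⁺ _∷_ (all∈ w) (∈-words all∈ ws)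

∃-with-counts? : ∀ {P : List (Fin 3) → Set} → Decidable P → ∀ k → Dec (∃ λ js → Counts js k × P js)
∃-with-counts? P? k
  with any? (λ js → all? (λ i → count i js ≟ k i) ×-dec P? js) (words (allFin 3) (k 0F + (k 1F + k 2F)))
... | yes found = yes (satisfied found)
... | no none   = no λ (js , counts , pjs) → none (lose (candidate js counts) (counts , pjs))
  where
  candidate : ∀ js → Counts js k → js ∈ words (allFin 3) (k 0F + (k 1F + k 2F))
  candidate js counts = subst (λ n → js ∈ words (allFin 3) n)
    (trans (length≡sum-of-counts js) (cong₂ _+_ (counts 0F) (cong₂ _+_ (counts 1F) (counts 2F))))
    (∈-words ∈-allFin js)

-- Optimality

minimal⇒flips : ∀ {x} → Minimal x → ∀ i → flips x i ≡ 1 ⊎ flips x i ≡ 2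
minimal⇒flips mx i = Sum.map (cong (_∸ 1)) (cong (_∸ 1)) (mx i)

minimal⇒flips≢0 : ∀ {x} → Minimal x → ∀ i → flips x i ≢ 0
minimal⇒flips≢0 {x} mx i with minimal⇒flips {x} mx i
... | inj₁ eq = λ eq′ → case trans (sym eq) eq′ of λ ()
... | inj₂ eq = λ eq′ → case trans (sym eq) eq′ of λ ()

complete-optimal-walk : ∀ f x W → IsTransientVector x → Minimal x →
  WalkFor x W → cost f W ≤ 1 → Complete f W → Σ (List Vertex) λ W → Complete f W × Optimal f x W
complete-optimal-walk f x W tx mx W-for cheap complete
  with ∃-with-counts? (λ js → cost f (trace (α x) js) ≟ 0) (flips x)
... | yes (js , counts , free) =
  trace (α x) js ,
  free-trace-complete f (α x) js free
    (λ i → count≢0⇒∈ js (minimal⇒flips≢0 {x} mx i ∘ trans (sym (counts i)))) ,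
  walkFor-trace {x} tx counts , λ _ _ → subst (_≤ _) (sym free) z≤n
... | no none = W , complete , W-for , λ W′ W′-for → ≤-trans cheap (costly W′ W′-for)
  where
  costly : ∀ W′ → WalkFor x W′ → 1 ≤ cost f W′
  costly W′ W′-for with walkFor⇒trace {x} tx W′-for
  ... | js , refl , counts = n≢0⇒n>0 λ free → none (js , counts , free)

-- Alternating walks

Covers : Fin 3 → Fin 3 → Fin 3 → Set
Covers a b c = ∀ k → k ≡ a ⊎ k ≡ b ⊎ k ≡ c

covers⇒all∈ : ∀ {a b c} → Covers a b c → ∀ k → k ∈ a ∷ b ∷ c ∷ []
covers⇒all∈ abc k with abc k
... | inj₁ k≡a        = here k≡a
... | inj₂ (inj₁ k≡b) = there (here k≡b)
... | inj₂ (inj₂ k≡c) = there (there (here k≡c))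

covers? : ∀ a b c → Dec (Covers a b c)
covers? a b c = all? λ k → k ≟F a ⊎-dec (k ≟F b ⊎-dec k ≟F c)

covers⇒distinct : ∀ a b c → Covers a b c → a ≢ b × a ≢ c × b ≢ c
covers⇒distinct = toWitness {a? = all? λ a → all? λ b → all? λ c →
  covers? a b c →-dec (¬? (a ≟F b) ×-dec ¬? (a ≟F c) ×-dec ¬? (b ≟F c))} _

covers-shift : ∀ {a b c d} → Covers a b c → Covers b c d → d ≡ a
covers-shift {a} {b} {c} abc bcd with bcd a | covers⇒distinct a b c abc
... | inj₁ a≡b        | a≢b , _       = ⊥-elim (a≢b a≡b)
... | inj₂ (inj₁ a≡c) | _ , a≢c , _   = ⊥-elim (a≢c a≡c)
... | inj₂ (inj₂ a≡d) | _             = sym a≡d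

changes⇒covers : ∀ v a b c →
  AllCoordsChanged v (toggle a v) (toggle b (toggle a v)) (toggle c (toggle b (toggle a v))) → Covers a b c
changes⇒covers v a b c changed k =
  Sum.map (toggle-differsAt v) (Sum.map (toggle-differsAt v₁) (toggle-differsAt (toggle b v₁))) (changed k)
  where v₁ = toggle a v

alternating-walk : ∀ {v₀ v₁ v₂ v₃ v₄ v₅} →
  IsWalk (v₀ ∷ v₁ ∷ v₂ ∷ v₃ ∷ v₄ ∷ v₅ ∷ []) → Alternating v₀ v₁ v₂ v₃ v₄ v₅ →
  ∃[ a ] ∃[ b ] ∃[ c ] Covers a b c × v₀ ∷ v₁ ∷ v₂ ∷ v₃ ∷ v₄ ∷ v₅ ∷ [] ≡ trace v₀ (a ∷ b ∷ c ∷ a ∷ b ∷ [])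
alternating-walk {v₀} walk (changed₁ , changed₂ , changed₃) with isWalk⇒trace walk
... | a ∷ b ∷ c ∷ d ∷ e ∷ [] , refl
  with refl ← covers-shift (changes⇒covers v₀ a b c changed₁) (changes⇒covers (toggle a v₀) b c d changed₂)
  with refl ← covers-shift (changes⇒covers (toggle a v₀) b c a changed₂)
                           (changes⇒covers (toggle b (toggle a v₀)) c a e changed₃)
  = a , b , c , changes⇒covers v₀ a b c changed₁ , refl

-- Relabelling letters

count-map-injective : ∀ {n} {π : Fin n → Fin n} → Injective _≡_ _≡_ π →
  ∀ t ts → count (π t) (List.map π ts) ≡ count t ts
count-map-injective inj t [] = refl
count-map-injective {π = π} inj t (s ∷ ts) with π t ≟F π s | t ≟F s
... | yes _     | yes _    = cong suc (count-map-injective inj t ts)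
... | no _      | no _     = count-map-injective inj t ts
... | yes πt≡πs | no t≢s   = ⊥-elim (t≢s (inj πt≡πs))
... | no πt≢πs  | yes refl = ⊥-elim (πt≢πs refl)

relabel : Fin 3 → Fin 3 → Fin 3 → Fin 3 → Fin 3
relabel a b c 0F = a
relabel a b c 1F = b
relabel a b c 2F = c

relabel-injective : ∀ {a b c} → Covers a b c → Injective _≡_ _≡_ (relabel a b c)
relabel-injective {a} {b} {c} abc {s} {t} eq with covers⇒distinct a b c abc
relabel-injective _ {0F} {0F} eq | _ = refl
relabel-injective _ {1F} {1F} eq | _ = refl
relabel-injective _ {2F} {2F} eq | _ = refl
relabel-injective _ {0F} {1F} eq | a≢b , _ , _ = ⊥-elim (a≢b eq)
relabel-injective _ {1F} {0F} eq | a≢b , _ , _ = ⊥-elim (a≢b (sym eq))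
relabel-injective _ {0F} {2F} eq | _ , a≢c , _ = ⊥-elim (a≢c eq)
relabel-injective _ {2F} {0F} eq | _ , a≢c , _ = ⊥-elim (a≢c (sym eq))
relabel-injective _ {1F} {2F} eq | _ , _ , b≢c = ⊥-elim (b≢c eq)
relabel-injective _ {2F} {1F} eq | _ , _ , b≢c = ⊥-elim (b≢c (sym eq))

relabel-surjective : ∀ {a b c} → Covers a b c → ∀ k → ∃ λ t → relabel a b c t ≡ k
relabel-surjective abc k with abc k
... | inj₁ k≡a        = 0F , sym k≡a
... | inj₂ (inj₁ k≡b) = 1F , sym k≡b
... | inj₂ (inj₂ k≡c) = 2F , sym k≡c

counts-relabel : ∀ {a b c} → Covers a b c →
  ∀ ts k → Counts ts (k ∘ relabel a b c) → Counts (List.map (relabel a b c) ts) k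
counts-relabel abc ts k counts i with relabel-surjective abc i
... | t , refl = trans (count-map-injective (relabel-injective abc) t ts) (counts t)

-- Cheap detours

module Detours (f : Vertex → Bool) (v : Vertex) (a b c : Fin 3)
  (free : cost f (trace v (a ∷ b ∷ c ∷ [])) ≡ 0)
  (cheap : cost f (trace v (a ∷ b ∷ c ∷ a ∷ b ∷ [])) ≤ 1) where

  retraced : cost f (trace v (a ∷ b ∷ c ∷ c ∷ b ∷ [])) ≡ 0
  retraced rewrite toggle-involutive c (toggle b (toggle a v)) | toggle-involutive b (toggle a v) =
    retrace-free f _ _ _ _ free

  free-prefix : ∀ js ks → cost f (trace v (js ++ ks)) ≡ 0 → cost f (trace v js) ≡ 0
  free-prefix js ks free′ = n≤0⇒n≡0 (subst (cost f (trace v js) ≤_) free′ (cost-trace-prefix f v js ks))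

  free⇒cheap : ∀ js → cost f (trace v js) ≡ 0 → cost f (trace v js) ≤ 1
  free⇒cheap js free′ = subst (_≤ 1) (sym free′) z≤n

  cheap-step : ∀ js k → cost f (trace v js) ≡ 0 → cost f (trace v (js ++ [ k ])) ≤ 1
  cheap-step js k free′ =
    subst (λ n → cost f (trace v (js ++ [ k ])) ≤ suc n) free′ (cost-trace-snoc f v js k)

  counted : ∀ ts {K : Fin 3 → ℕ} →
    K 0F ≡ count 0F ts → K 1F ≡ count 1F ts → K 2F ≡ count 2F ts → Counts ts K
  counted ts e₀ e₁ e₂ 0F = sym e₀
  counted ts e₀ e₁ e₂ 1F = sym e₁
  counted ts e₀ e₁ e₂ 2F = sym e₂

  -- Detours are spelled in the letters 0F, 1F, 2F, which relabel sends to a, b, c.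
  detour : (K : Fin 3 → ℕ) → (∀ t → K t ≡ 1 ⊎ K t ≡ 2) →
    ∃ λ rest → Counts (0F ∷ 1F ∷ 2F ∷ rest) K ×
               cost f (trace v (a ∷ b ∷ c ∷ List.map (relabel a b c) rest)) ≤ 1
  detour K shape with shape 0F | shape 1F | shape 2F
  ... | inj₁ e₀ | inj₁ e₁ | inj₁ e₂ = [] , counted _ e₀ e₁ e₂ ,
    free⇒cheap (a ∷ b ∷ c ∷ []) free
  ... | inj₂ e₀ | inj₁ e₁ | inj₁ e₂ = 0F ∷ [] , counted _ e₀ e₁ e₂ ,
    ≤-trans (cost-trace-prefix f v (a ∷ b ∷ c ∷ a ∷ []) [ b ]) cheap
  ... | inj₁ e₀ | inj₂ e₁ | inj₁ e₂ = 1F ∷ [] , counted _ e₀ e₁ e₂ ,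
    cheap-step (a ∷ b ∷ c ∷ []) b free
  ... | inj₁ e₀ | inj₁ e₁ | inj₂ e₂ = 2F ∷ [] , counted _ e₀ e₁ e₂ ,
    free⇒cheap (a ∷ b ∷ c ∷ c ∷ []) (free-prefix (a ∷ b ∷ c ∷ c ∷ []) [ b ] retraced)
  ... | inj₂ e₀ | inj₂ e₁ | inj₁ e₂ = 0F ∷ 1F ∷ [] , counted _ e₀ e₁ e₂ ,
    cheap
  ... | inj₂ e₀ | inj₁ e₁ | inj₂ e₂ = 2F ∷ 0F ∷ [] , counted _ e₀ e₁ e₂ ,
    cheap-step (a ∷ b ∷ c ∷ c ∷ []) a (free-prefix (a ∷ b ∷ c ∷ c ∷ []) [ b ] retraced)
  ... | inj₁ e₀ | inj₂ e₁ | inj₂ e₂ = 2F ∷ 1F ∷ [] , counted _ e₀ e₁ e₂ ,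
    free⇒cheap (a ∷ b ∷ c ∷ c ∷ b ∷ []) retraced
  ... | inj₂ e₀ | inj₂ e₁ | inj₂ e₂ = 2F ∷ 1F ∷ 0F ∷ [] , counted _ e₀ e₁ e₂ ,
    cheap-step (a ∷ b ∷ c ∷ c ∷ b ∷ []) a retraced

lemma3 : (f : Vertex → Bool) (x : TVec) → IsTransientVector x → Minimal x →
    (v0 v1 v2 v3 v4 v5 : Vertex) → v0 ≡ α x →
    IsWalk (v0 ∷ v1 ∷ v2 ∷ v3 ∷ []) →
    IsWalk (v0 ∷ v1 ∷ v2 ∷ v3 ∷ v4 ∷ v5 ∷ []) →
    Alternating v0 v1 v2 v3 v4 v5 →
    cost f (v0 ∷ v1 ∷ v2 ∷ v3 ∷ []) ≡ 0 →
    cost f (v0 ∷ v1 ∷ v2 ∷ v3 ∷ v4 ∷ v5 ∷ []) ≤ 1 →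
    Σ (List Vertex) λ W → Complete f W × Optimal f x W
-- The walk hypothesis on U is implied by the one on W.
lemma3 f x tx mx _ _ _ _ _ _ refl _ walk alt free cheap with alternating-walk walk alt
... | a , b , c , abc , refl =
  let rest , counts , cost≤1 = detour (flips x ∘ relabel a b c) (minimal⇒flips {x} mx ∘ relabel a b c)
      detoured = a ∷ b ∷ c ∷ List.map (relabel a b c) rest
  in complete-optimal-walk f x (trace (α x) detoured) tx mx
       (walkFor-trace {x} tx (counts-relabel abc (0F ∷ 1F ∷ 2F ∷ rest) (flips x) counts))
       cost≤1
       (complete-trace-++ f (α x) (a ∷ b ∷ c ∷ []) _ (free-trace-complete f (α x) _ free (covers⇒all∈ abc)))
  where open Detours f (α x) a b c free cheap
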